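{- Let $h_1\ge h_2>0$ be integers. A $\mathrm{LC}(h_1h_2)$ exists if and only if $h_1=h_2$.
   Context: A latin cube of order $N$ is an $N\times N\times N$ array on $N$ symbols such that any two cells whose coordinates differ in exactly one position contain different symbols; a subcube is an $m\times m\times m$ subarray (indices in each coordinate from chosen $m$-sets) that is itself a latin cube of order $m$; subcubes are disjoint if they share no index in any coordinate and no symbol. A $\mathrm{LC}(h_1h_2)$ is a latin cube of order $h_1+h_2$ with two disjoint subcubes of orders $h_1$ and $h_2$. -}

module Defs where

open import Data.Nat using (ℕ; _+_)
open import Data.Fin using (Fin)
open import Data.Product using (Σ; ∃; _×_)
open import Relation.Binary.PropositionalEquality using (_≡_; _≢_)
open import Relation.Nullary using (¬_)
open import Function.Definitions using (Injective)

Cube : ℕ → Set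
Cube n = Fin n → Fin n → Fin n → Fin n

IsLatinCube : (n : ℕ) → Cube n → Set
IsLatinCube n L =
    (∀ x x′ y z → x ≢ x′ → L x y z ≢ L x′ y z)
  × (∀ x y y′ z → y ≢ y′ → L x y z ≢ L x y′ z)
  × (∀ x y z z′ → z ≢ z′ → L x y z ≢ L x y z′)

-- A subcube of order m of a cube of order n: m-sets of indices in each
-- coordinate (given by injections R, C, F : Fin m → Fin n) and an m-set of
-- symbols (injection S) such that the m×m×m subarray is a latin cube of
-- order m on the symbol set S, i.e. every entry of the subarray lies in S
-- (the latin property of the subarray is inherited from the latin cube).
record Subcube (n : ℕ) (L : Cube n) (m : ℕ) : Set where
  field
    R C F S : Fin m → Fin n
    R-inj : Injective _≡_ _≡_ R
    C-inj : Injective _≡_ _≡_ C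
    F-inj : Injective _≡_ _≡_ F
    S-inj : Injective _≡_ _≡_ S
    closed : ∀ i j k → ∃ λ t → L (R i) (C j) (F k) ≡ S t

DisjointImages : {a b n : ℕ} → (Fin a → Fin n) → (Fin b → Fin n) → Set
DisjointImages f g = ∀ i j → f i ≢ g j

Disjoint : {n : ℕ} {L : Cube n} {a b : ℕ} → Subcube n L a → Subcube n L b → Set
Disjoint P Q =
    DisjointImages (Subcube.R P) (Subcube.R Q)
  × DisjointImages (Subcube.C P) (Subcube.C Q)
  × DisjointImages (Subcube.F P) (Subcube.F Q)
  × DisjointImages (Subcube.S P) (Subcube.S Q)

LC : ℕ → ℕ → Set
LC h₁ h₂ =
  Σ (Cube (h₁ + h₂)) λ L →
    IsLatinCube (h₁ + h₂) L ×
    Σ (Subcube (h₁ + h₂) L h₁) λ P →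
    Σ (Subcube (h₁ + h₂) L h₂) λ Q →
      Disjoint P Q

-- Fix a column j of the order-h₁ subcube P and a file z of the order-h₂ subcube Q.
-- For each row i of P, the line through (i, j) already meets all h₁ symbols of P
-- inside P, so the symbol in file z is new; these h₁ new symbols are distinct, giving
-- h₁ + h₁ ≤ h₁ + h₂.  Conversely, x + y + z over ℤ₂ × ℤ_h is a latin cube of order 2h
-- in which the two cosets of ℤ_h are disjoint subcubes.
module Submission where

open import Defs
open import Data.Nat using (ℕ; _≤_; _<_)
open import Data.Product using (_×_)
open import Relation.Binary.PropositionalEquality using (_≡_)

open import Algebra.Core using (Op₂)
open import Algebra.Definitions using (Commutative; LeftCancellative; RightCancellative)
open import Algebra.Consequences.Propositional using (comm∧cancelˡ⇒cancelʳ)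
open import Data.Empty using (⊥-elim)
open import Data.Fin using (Fin; zero; suc; toℕ; _≟_)
open import Data.Fin.Properties using (injective⇒≤; toℕ-injective; toℕ-fromℕ<; toℕ<n; +↔⊎)
open import Data.Nat using (suc; _+_; _∸_; _*_; NonZero; z≤n)
open import Data.Nat.DivMod
  using (_%_; _/_; _mod_; m≡m%n+[m/n]*n; m%n≤n; [m+kn]%n≡m%n; m<n⇒m%n≡m; %-distribˡ-+)
open import Data.Nat.Properties using (+-comm; m∸n+n≡m; 1+n≰n; +-cancelˡ-≤; ≤-antisym)
open import Data.Nat.Tactic.RingSolver using (solve-∀)
open import Data.Product using (∃; _,_; proj₁; proj₂)
open import Data.Sum using (_⊎_; inj₁; inj₂; [_,_]′)
open import Data.Sum.Properties using (inj₁-injective; inj₂-injective)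
open import Function.Bundles using (_↔_; Inverse; Injection)
open import Function.Construct.Symmetry using (↔-sym)
open import Function.Definitions using (Injective)
open import Function.Properties.Inverse using (↔⇒↣)
open import Relation.Nullary using (¬_)
open import Relation.Nullary.Decidable using (decidable-stable)
open import Relation.Binary.PropositionalEquality
  using (_≢_; refl; sym; trans; cong; module ≡-Reasoning)

↔-injective : ∀ {A B : Set} (A↔B : A ↔ B) → Injective _≡_ _≡_ (Inverse.to A↔B)
↔-injective A↔B = Injection.injective (↔⇒↣ A↔B)

contra⇒injective : ∀ {n} {A : Set} {f : Fin n → A} →
                   (∀ x y → x ≢ y → f x ≢ f y) → Injective _≡_ _≡_ f
contra⇒injective sep {x} {y} fx≡fy = decidable-stable (x ≟ y) (λ x≢y → sep x y x≢y fx≡fy)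

injective⇒¬avoids : ∀ {n} {f : Fin n → Fin n} → Injective _≡_ _≡_ f →
                    ∀ y → ¬ (∀ x → f x ≢ y)
injective⇒¬avoids {n} {f} f-inj y avoids = 1+n≰n (injective⇒≤ g-inj)
  where
  g : Fin (suc n) → Fin n
  g zero    = y
  g (suc x) = f x

  g-inj : Injective _≡_ _≡_ g
  g-inj {zero}  {zero}   _ = refl
  g-inj {zero}  {suc x}  e = ⊥-elim (avoids x (sym e))
  g-inj {suc x} {zero}   e = ⊥-elim (avoids x e)
  g-inj {suc x} {suc x′} e = cong suc (f-inj e)

module _ {n : ℕ} {L : Cube n} (latin : IsLatinCube n L) where

  latin-injective₁ : ∀ y z → Injective _≡_ _≡_ (λ x → L x y z)
  latin-injective₁ y z = contra⇒injective (λ x x′ → proj₁ latin x x′ y z)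

  latin-injective₃ : ∀ x y → Injective _≡_ _≡_ (L x y)
  latin-injective₃ x y = contra⇒injective (proj₂ (proj₂ latin) x y)

  module _ {m : ℕ} (P : Subcube n L m) where
    open Subcube P

    -- Within P the line through (R i, C j) is injective from m files into m symbols,
    -- so it exhausts the symbols of P.
    outside-line∉symbols : ∀ i j z → (∀ k → F k ≢ z) → ∀ t → L (R i) (C j) z ≢ S t
    outside-line∉symbols i j z z∉F t line≡t = injective⇒¬avoids symbol-inj t avoids
      where
      symbol : Fin m → Fin m
      symbol k = proj₁ (closed i j k)

      file-of-symbol : ∀ k {w} → L (R i) (C j) w ≡ S (symbol k) → F k ≡ w
      file-of-symbol k e = latin-injective₃ (R i) (C j) (trans (proj₂ (closed i j k)) (sym e))

      symbol-inj : Injective _≡_ _≡_ symbol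
      symbol-inj {k} {k′} e =
        F-inj (file-of-symbol k (trans (proj₂ (closed i j k′)) (cong S (sym e))))

      avoids : ∀ k → symbol k ≢ t
      avoids k e = z∉F k (file-of-symbol k (trans line≡t (cong S (sym e))))

subcube-order-half : ∀ {n m} {L : Cube n} → IsLatinCube n L → (P : Subcube n L m) →
                     ∀ z → (∀ k → Subcube.F P k ≢ z) → m + m ≤ n
subcube-order-half {m = ℕ.zero} _ _ _ _ = z≤n
subcube-order-half {n} {suc m} {L} latin P z z∉F =
  injective⇒≤ (λ e → ↔-injective +↔⊎ (symbols-inj e))
  where
  open Subcube P

  fresh : ∀ i s → L (R i) (C zero) z ≢ S s
  fresh i = outside-line∉symbols latin P i zero z z∉F

  symbols : Fin (suc m) ⊎ Fin (suc m) → Fin n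
  symbols = [ S , (λ i → L (R i) (C zero) z) ]′

  symbols-inj : Injective _≡_ _≡_ symbols
  symbols-inj {inj₁ s} {inj₁ s′} e = cong inj₁ (S-inj e)
  symbols-inj {inj₁ s} {inj₂ i}  e = ⊥-elim (fresh i s (sym e))
  symbols-inj {inj₂ i} {inj₁ s}  e = ⊥-elim (fresh i s e)
  symbols-inj {inj₂ i} {inj₂ i′} e = cong inj₂ (R-inj (latin-injective₁ latin (C zero) z e))

LC⇒≤ : ∀ {h₁ h₂} → LC h₁ (suc h₂) → h₁ ≤ suc h₂
LC⇒≤ {h₁} (_ , latin , P , Q , _ , _ , disjoint-files , _) =
  +-cancelˡ-≤ h₁ _ _ (subcube-order-half latin P (Subcube.F Q zero) (λ k → disjoint-files k zero))

[d∸m%d+[m+n]]%d≡n : ∀ m {n} d .{{_ : NonZero d}} → n < d → ((d ∸ m % d) + (m + n)) % d ≡ n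
[d∸m%d+[m+n]]%d≡n m {n} d n<d = begin
  (c + (m + n)) % d           ≡⟨ cong (λ k → (c + (k + n)) % d) (m≡m%n+[m/n]*n m d) ⟩
  (c + ((r + q * d) + n)) % d ≡⟨ cong (_% d) (regroup c r (q * d) n) ⟩
  (n + (c + r + q * d)) % d   ≡⟨ cong (λ k → (n + (k + q * d)) % d) (m∸n+n≡m (m%n≤n m d)) ⟩
  (n + suc q * d) % d         ≡⟨ [m+kn]%n≡m%n n (suc q) d ⟩
  n % d                       ≡⟨ m<n⇒m%n≡m n<d ⟩
  n                           ∎
  where
  open ≡-Reasoning
  r q c : ℕ
  r = m % d
  q = m / d
  c = d ∸ r
  regroup : ∀ a b e f → a + ((b + e) + f) ≡ f + (a + b + e)
  regroup = solve-∀

[m+n]%d≡[m+o]%d⇒n≡o : ∀ m {n o} d .{{_ : NonZero d}} → n < d → o < d →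
                       (m + n) % d ≡ (m + o) % d → n ≡ o
[m+n]%d≡[m+o]%d⇒n≡o m {n} {o} d n<d o<d e = begin
  n                             ≡⟨ sym ([d∸m%d+[m+n]]%d≡n m d n<d) ⟩
  (c + (m + n)) % d             ≡⟨ %-distribˡ-+ c (m + n) d ⟩
  (c % d + (m + n) % d) % d     ≡⟨ cong (λ k → (c % d + k) % d) e ⟩
  (c % d + (m + o) % d) % d     ≡⟨ sym (%-distribˡ-+ c (m + o) d) ⟩
  (c + (m + o)) % d             ≡⟨ [d∸m%d+[m+n]]%d≡n m d o<d ⟩
  o                             ∎
  where
  open ≡-Reasoning
  c : ℕ
  c = d ∸ m % d

module _ (h : ℕ) .{{_ : NonZero h}} where

  _+ₕ_ : Op₂ (Fin h)
  i +ₕ j = (toℕ i + toℕ j) mod h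

  +ₕ-comm : Commutative _≡_ _+ₕ_
  +ₕ-comm i j = cong (_mod h) (+-comm (toℕ i) (toℕ j))

  +ₕ-cancelˡ : LeftCancellative _≡_ _+ₕ_
  +ₕ-cancelˡ i j k e = toℕ-injective
    ([m+n]%d≡[m+o]%d⇒n≡o (toℕ i) h (toℕ<n j) (toℕ<n k)
      (trans (sym (toℕ-fromℕ< _)) (trans (cong toℕ e) (toℕ-fromℕ< _))))

-- B ⊎ B stands for B × ℤ₂: inj₁ is the even layer and inj₂ the odd one.
module Doubling {B : Set} (_∙_ : Op₂ B) where

  _⊕_ : Op₂ (B ⊎ B)
  inj₁ i ⊕ inj₁ j = inj₁ (i ∙ j)
  inj₁ i ⊕ inj₂ j = inj₂ (i ∙ j)
  inj₂ i ⊕ inj₁ j = inj₂ (i ∙ j)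
  inj₂ i ⊕ inj₂ j = inj₁ (i ∙ j)

  ⊕-comm : Commutative _≡_ _∙_ → Commutative _≡_ _⊕_
  ⊕-comm comm (inj₁ i) (inj₁ j) = cong inj₁ (comm i j)
  ⊕-comm comm (inj₁ i) (inj₂ j) = cong inj₂ (comm i j)
  ⊕-comm comm (inj₂ i) (inj₁ j) = cong inj₂ (comm i j)
  ⊕-comm comm (inj₂ i) (inj₂ j) = cong inj₁ (comm i j)

  ⊕-cancelˡ : LeftCancellative _≡_ _∙_ → LeftCancellative _≡_ _⊕_
  ⊕-cancelˡ cancel (inj₁ i) (inj₁ j) (inj₁ k) e = cong inj₁ (cancel i j k (inj₁-injective e))
  ⊕-cancelˡ cancel (inj₁ i) (inj₂ j) (inj₂ k) e = cong inj₂ (cancel i j k (inj₂-injective e))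
  ⊕-cancelˡ cancel (inj₂ i) (inj₁ j) (inj₁ k) e = cong inj₁ (cancel i j k (inj₂-injective e))
  ⊕-cancelˡ cancel (inj₂ i) (inj₂ j) (inj₂ k) e = cong inj₂ (cancel i j k (inj₁-injective e))
  ⊕-cancelˡ cancel (inj₁ _) (inj₁ _) (inj₂ _) ()
  ⊕-cancelˡ cancel (inj₁ _) (inj₂ _) (inj₁ _) ()
  ⊕-cancelˡ cancel (inj₂ _) (inj₁ _) (inj₂ _) ()
  ⊕-cancelˡ cancel (inj₂ _) (inj₂ _) (inj₁ _) ()

module QuasigroupCube {A : Set} (_∙_ : Op₂ A)
  (comm : Commutative _≡_ _∙_) (cancelˡ : LeftCancellative _≡_ _∙_)
  {n : ℕ} (Fin↔A : Fin n ↔ A) where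

  open Inverse Fin↔A

  cancelʳ : RightCancellative _≡_ _∙_
  cancelʳ = comm∧cancelˡ⇒cancelʳ comm cancelˡ

  to-inj : Injective _≡_ _≡_ to
  to-inj = ↔-injective Fin↔A

  from-inj : Injective _≡_ _≡_ from
  from-inj = ↔-injective (↔-sym Fin↔A)

  cube : Cube n
  cube x y z = from ((to x ∙ to y) ∙ to z)

  cube-isLatin : IsLatinCube n cube
  cube-isLatin =
      (λ x x′ y z x≢x′ e → x≢x′ (to-inj (cancelʳ _ _ _ (cancelʳ _ _ _ (from-inj e)))))
    , (λ x y y′ z y≢y′ e → y≢y′ (to-inj (cancelˡ _ _ _ (cancelʳ _ _ _ (from-inj e)))))
    , (λ x y z z′ z≢z′ e → z≢z′ (to-inj (cancelˡ _ _ _ (from-inj e))))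

  cube-from : ∀ a b c → cube (from a) (from b) (from c) ≡ from ((a ∙ b) ∙ c)
  cube-from a b c
    rewrite strictlyInverseˡ a | strictlyInverseˡ b | strictlyInverseˡ c = refl

  record ClosedEmbedding (m : ℕ) : Set where
    field
      embed     : Fin m → A
      embed-inj : Injective _≡_ _≡_ embed
      closed    : ∀ i j k → ∃ λ t → (embed i ∙ embed j) ∙ embed k ≡ embed t

  open ClosedEmbedding

  subcube : ∀ {m} → ClosedEmbedding m → Subcube n cube m
  subcube {m} E = record
    { R = from∘e ; C = from∘e ; F = from∘e ; S = from∘e
    ; R-inj = inj ; C-inj = inj ; F-inj = inj ; S-inj = inj
    ; closed = λ i j k → let t , eq = closed E i j k in
        t , trans (cube-from (embed E i) (embed E j) (embed E k)) (cong from eq)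
    }
    where
    from∘e : Fin m → Fin n
    from∘e i = from (embed E i)

    inj : Injective _≡_ _≡_ from∘e
    inj eq = embed-inj E (from-inj eq)

  subcubes-disjoint : ∀ {a b} (E₁ : ClosedEmbedding a) (E₂ : ClosedEmbedding b) →
                      (∀ i j → embed E₁ i ≢ embed E₂ j) → Disjoint (subcube E₁) (subcube E₂)
  subcubes-disjoint E₁ E₂ apart = separate , separate , separate , separate
    where
    separate : DisjointImages (λ i → from (embed E₁ i)) (λ j → from (embed E₂ j))
    separate i j eq = apart i j (from-inj eq)

LC-exists : ∀ h .{{_ : NonZero h}} → LC h h
LC-exists h =
  cube , cube-isLatin , subcube even , subcube odd , subcubes-disjoint even odd (λ _ _ ())
  where
  open Doubling (_+ₕ_ h)
  open QuasigroupCube _⊕_ (⊕-comm (+ₕ-comm h)) (⊕-cancelˡ (+ₕ-cancelˡ h)) +↔⊎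

  even odd : ClosedEmbedding h
  even = record { embed = inj₁ ; embed-inj = inj₁-injective ; closed = λ _ _ _ → _ , refl }
  odd  = record { embed = inj₂ ; embed-inj = inj₂-injective ; closed = λ _ _ _ → _ , refl }

lemma13 : (h₁ h₂ : ℕ) → h₂ ≤ h₁ → 0 < h₂ →
          (LC h₁ h₂ → h₁ ≡ h₂) × (h₁ ≡ h₂ → LC h₁ h₂)
lemma13 h₁ (suc h) h₂≤h₁ _ = (λ lc → ≤-antisym (LC⇒≤ lc) h₂≤h₁) , λ { refl → LC-exists h₁ }
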